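{- Let $X$ be a minimum zero forcing set of a graph $G$, and let $\{u_1,\ldots,u_k\}$ be a set of $k$ vertices that are terminals of forcing chains associated with $X$ (i.e., there is a chronological list of forces for $X$ in $G$ in which each $u_i$ is a terminal of a forcing chain). Let $H_1,\ldots,H_k$ be pairwise vertex-disjoint connected graphs with $V(H_i)\cap V(G)=\{u_i\}$ for $1\le i\le k$, and let $G'=G\cup H_1\cup\cdots\cup H_k$. Then \[Z(G';X)=|X|-k+\sum_{i=1}^k Z(H_i;\{u_i\}).\]
   Context: All graphs are finite, simple and undirected. Zero forcing: for a set of blue vertices (others white), if a blue vertex $u$ has exactly one white neighbor $w$, then $u$ forces $w$ (written $u\to w$) and $w$ becomes blue. $B$ is a zero forcing set if repeatedly applying this rule starting from $B$ colors all vertices; a minimum zero forcing set is one of minimum cardinality, and $Z(H;Y)$ denotes the minimum size of a zero forcing set of $H$ containing $Y$. A chronological list of forces for $B$ is a sequence of forces applied, in order, to color all vertices starting from $B$. A forcing chain is a maximal sequence $(v_1,\ldots,v_m)$ with $v_i\to v_{i+1}$ in the list; its last vertex is its terminal (possibly equal to its first vertex, which lies in $B$). $G\cup H_1\cup\cdots\cup H_k$ is the graph whose vertex and edge sets are the unions of those of the constituent graphs. -}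

module Defs where

open import Data.Nat using (ℕ; _≤_; _+_; _∸_)
open import Data.Bool using (Bool; true; false; _∨_)
open import Data.Fin using (Fin)
open import Data.List using (List; []; _∷_; length; map; concatMap; allFin)
open import Data.Bool.ListAction using (or)
open import Data.Nat.ListAction using (sum)
open import Data.List.Membership.Propositional using (_∈_; _∉_)
open import Data.List.Relation.Unary.Unique.Propositional using (Unique)
open import Data.Product using (_×_; _,_; Σ; ∃; ∃-syntax)
open import Data.Sum using (_⊎_)
open import Relation.Binary.PropositionalEquality using (_≡_; _≢_)
open import Relation.Nullary using (¬_)

record Graph : Set where
  constructor mkGraph
  field
    V   : List ℕ
    adj : ℕ → ℕ → Bool
open Graph public

record Simple (G : Graph) : Set where
  field
    sym     : ∀ x y → adj G x y ≡ adj G y x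
    irrefl  : ∀ x → adj G x x ≡ false
    inV     : ∀ x y → adj G x y ≡ true → x ∈ V G
open Simple public

data Walk (G : Graph) : ℕ → ℕ → Set where
  here : ∀ {x} → x ∈ V G → Walk G x x
  step : ∀ {x y z} → adj G x y ≡ true → Walk G y z → Walk G x z

Connected : Graph → Set
Connected G = ∀ x y → x ∈ V G → y ∈ V G → Walk G x y

union : (G : Graph) (k : ℕ) (H : Fin k → Graph) → Graph
union G k H = mkGraph (V G Data.List.++ concatMap (λ i → V (H i)) (allFin k))
                      (λ x y → adj G x y ∨ or (map (λ i → adj (H i) x y) (allFin k)))

VSet : Graph → List ℕ → Set
VSet G B = Unique B × (∀ v → v ∈ B → v ∈ V G)

_⊆_ : List ℕ → List ℕ → Set
A ⊆ B = ∀ v → v ∈ A → v ∈ B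

-- u → w is a valid force when the current blue set is S
ValidForce : Graph → List ℕ → ℕ → ℕ → Set
ValidForce G S u w =
  u ∈ S × w ∈ V G × w ∉ S × adj G u w ≡ true ×
  (∀ x → x ∈ V G → adj G u x ≡ true → x ∈ S ⊎ x ≡ w)

data Chrono (G : Graph) : List ℕ → List (ℕ × ℕ) → Set where
  done  : ∀ {S} → (∀ v → v ∈ V G → v ∈ S) → Chrono G S []
  force : ∀ {S u w L} → ValidForce G S u w → Chrono G (w ∷ S) L →
          Chrono G S ((u , w) ∷ L)

ChronList : Graph → List ℕ → List (ℕ × ℕ) → Set
ChronList G B L = Chrono G B L

ZeroForcingSet : Graph → List ℕ → Set
ZeroForcingSet G B = VSet G B × ∃[ L ] ChronList G B L

MinZeroForcingSet : Graph → List ℕ → Set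
MinZeroForcingSet G X =
  ZeroForcingSet G X × (∀ B → ZeroForcingSet G B → length X ≤ length B)

-- ChainTo L a t : a maximal forcing path a = v_1 → v_2 → ... → v_m = t
-- in L, with t forcing nothing.
data ChainTo (L : List (ℕ × ℕ)) : ℕ → ℕ → Set where
  end  : ∀ {t} → (∀ w → (t , w) ∉ L) → ChainTo L t t
  next : ∀ {u w t} → (u , w) ∈ L → ChainTo L w t → ChainTo L u t

IsTerminal : List ℕ → List (ℕ × ℕ) → ℕ → Set
IsTerminal B L t = ∃[ a ] (a ∈ B × ChainTo L a t)

-- IsZ H Y n : n = Z(H;Y), the minimum size of a zero forcing set of H containing Y
IsZ : Graph → List ℕ → ℕ → Set
IsZ H Y n =
  (∃[ B ] (ZeroForcingSet H B × Y ⊆ B × length B ≡ n)) ×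
  (∀ B → ZeroForcingSet H B → Y ⊆ B → n ≤ length B)

Σ[_]_ : (k : ℕ) → (Fin k → ℕ) → ℕ
Σ[ k ] f = sum (map f (allFin k))

-- The only vertices of G with neighbours outside G are the u i, and as terminals they never force.
-- Hence a chronological list of forces of X in G is still valid in G′, and afterwards each H i can
-- be forced from u i together with the rest of a minimum zero forcing set Bᵢ of H i containing u i:
-- this gives a zero forcing set of G′ of size |X| + Σ (|Bᵢ| - 1). Conversely, replaying the forces
-- of any zero forcing set B ⊇ X of G′ inside H i shows that u i together with the vertices of B in
-- V(H i) ∖ {u i} forces H i, so B has at least z i - 1 such vertices for each i besides X ⊆ V(G).
-- Finally k ≤ |X|, since distinct terminals start distinct forcing chains, so no truncation occurs.
module Submission where

open import Defs hiding (sym)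
open import Data.Nat using (ℕ; suc; _+_; _∸_; _≤_; z≤n)
open import Data.Nat.Properties
  using (_≟_; +-assoc; +-comm; +-suc; +-mono-≤; +-monoʳ-≤; m∸n+n≡m; ≤-antisym; module ≤-Reasoning)
open import Data.Nat.ListAction using (sum)
open import Data.Bool using (Bool; true; false; _∨_)
open import Data.Bool.ListAction using (or)
open import Data.Bool.Properties using (T-∨; T-≡)
open import Data.Fin using (Fin) renaming (zero to fzero; suc to fsuc)
open import Data.Fin.Properties using (injective⇒≤) renaming (_≟_ to _≟ᶠ_)
open import Data.List using (List; []; _∷_; _++_; length; map; concatMap; allFin; lookup; filter)
open import Data.List.Properties using (length-++; length-map; length-tabulate; map-cong)
open import Data.List.Relation.Unary.All as All using ()
open import Data.List.Relation.Unary.Any using (here; there; index; satisfied)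
open import Data.List.Relation.Unary.Any.Properties using (lookup-index; any⁺; any⁻)
open import Data.List.Membership.Propositional using (_∈_; _∉_; lose; find)
open import Data.List.Membership.Propositional.Properties
  using (∈-lookup; ∈-map⁻; ∈-++⁺ˡ; ∈-++⁺ʳ; ∈-++⁻; ∈-concatMap⁺; ∈-concatMap⁻; ∈-allFin; ∈-filter⁺; ∈-filter⁻)
open import Data.List.Membership.DecPropositional _≟_ using (_∈?_)
open import Data.List.Relation.Unary.Unique.Propositional using (Unique; []; _∷_)
import Data.List.Relation.Unary.Unique.Propositional.Properties as Unique
open import Data.Product using (_×_; _,_; proj₁; proj₂; ∃-syntax; ∃₂)
open import Data.Sum using (_⊎_; inj₁; inj₂; map₂)
open import Data.Empty using (⊥; ⊥-elim)
open import Function using (Equivalence)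
open import Function.Definitions using (Injective)
open import Relation.Nullary using (Dec; yes; no; ¬?)
open import Relation.Nullary.Decidable using (_×-dec_)
open import Relation.Binary.PropositionalEquality
  using (_≡_; _≢_; refl; sym; trans; cong; cong₂; subst; module ≡-Reasoning)

open Equivalence using (to; from)

lookup-injective : ∀ {A : Set} {xs : List A} → Unique xs → ∀ i j → lookup xs i ≡ lookup xs j → i ≡ j
lookup-injective (_ ∷ _) fzero fzero _ = refl
lookup-injective (x∉ ∷ _) fzero (fsuc j) eq = ⊥-elim (All.lookup x∉ (∈-lookup j) eq)
lookup-injective (x∉ ∷ _) (fsuc i) fzero eq = ⊥-elim (All.lookup x∉ (∈-lookup i) (sym eq))
lookup-injective (_ ∷ xs!) (fsuc i) (fsuc j) eq = cong fsuc (lookup-injective xs! i j eq)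

Unique-⊆⇒length≤ : ∀ {xs ys : List ℕ} → Unique xs → xs ⊆ ys → length xs ≤ length ys
Unique-⊆⇒length≤ {xs} {ys} xs! xs⊆ys = injective⇒≤ position-injective
  where
  position : Fin (length xs) → Fin (length ys)
  position i = index (xs⊆ys (lookup xs i) (∈-lookup i))
  position-injective : Injective _≡_ _≡_ position
  position-injective {i} {j} eq = lookup-injective xs! i j (begin
    lookup xs i               ≡⟨ lookup-index (xs⊆ys _ (∈-lookup i)) ⟩
    lookup ys (position i)    ≡⟨ cong (lookup ys) eq ⟩
    lookup ys (position j)    ≡⟨ sym (lookup-index (xs⊆ys _ (∈-lookup j))) ⟩
    lookup xs j               ∎)
    where open ≡-Reasoning

Unique-concatMap⁺ : ∀ {A B : Set} {f : A → List B} {xs : List A} → Unique xs →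
  (∀ x → Unique (f x)) → (∀ {x y v} → v ∈ f x → v ∈ f y → x ≡ y) → Unique (concatMap f xs)
Unique-concatMap⁺ [] _ _ = []
Unique-concatMap⁺ {f = f} {x ∷ xs} (x∉ ∷ xs!) f! f-disjoint =
  Unique.++⁺ (f! x) (Unique-concatMap⁺ xs! f! f-disjoint) disjoint
  where
  disjoint : ∀ {v} → v ∈ f x × v ∈ concatMap f xs → ⊥
  disjoint (v∈fx , v∈rest) with find (∈-concatMap⁻ f {xs = xs} v∈rest)
  ... | y , y∈xs , v∈fy = All.lookup x∉ y∈xs (f-disjoint v∈fx v∈fy)

length-concatMap : ∀ {A B : Set} (f : A → List B) (xs : List A) →
  length (concatMap f xs) ≡ sum (map (λ x → length (f x)) xs)
length-concatMap f [] = refl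
length-concatMap f (x ∷ xs) = trans (length-++ (f x)) (cong (length (f x) +_) (length-concatMap f xs))

sum-map-suc : ∀ {A : Set} (f : A → ℕ) (xs : List A) →
  sum (map (λ x → suc (f x)) xs) ≡ sum (map f xs) + length xs
sum-map-suc f [] = refl
sum-map-suc f (x ∷ xs) = begin
  suc (f x + sum (map (λ y → suc (f y)) xs))  ≡⟨ cong (λ s → suc (f x + s)) (sum-map-suc f xs) ⟩
  suc (f x + (sum (map f xs) + length xs))    ≡⟨ cong suc (sym (+-assoc (f x) _ _)) ⟩
  suc (f x + sum (map f xs) + length xs)      ≡⟨ sym (+-suc _ (length xs)) ⟩
  f x + sum (map f xs) + suc (length xs)      ∎
  where open ≡-Reasoning

sum-map-mono : ∀ {A : Set} {f g : A → ℕ} → (∀ x → f x ≤ g x) → ∀ xs → sum (map f xs) ≤ sum (map g xs)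
sum-map-mono f≤g [] = z≤n
sum-map-mono f≤g (x ∷ xs) = +-mono-≤ (f≤g x) (sum-map-mono f≤g xs)

length-++-concatMap : ∀ (X : List ℕ) k (Q : Fin k → List ℕ) → k ≤ length X →
  length (X ++ concatMap Q (allFin k)) ≡ (length X ∸ k) + Σ[ k ] (λ i → suc (length (Q i)))
length-++-concatMap X k Q k≤X = begin
  length (X ++ concatMap Q (allFin k))
    ≡⟨ length-++ X ⟩
  length X + length (concatMap Q (allFin k))
    ≡⟨ cong (length X +_) (length-concatMap Q (allFin k)) ⟩
  length X + s
    ≡⟨ cong (_+ s) (sym (m∸n+n≡m k≤X)) ⟩
  length X ∸ k + k + s
    ≡⟨ +-assoc (length X ∸ k) k s ⟩
  length X ∸ k + (k + s)
    ≡⟨ cong (length X ∸ k +_) (+-comm k s) ⟩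
  length X ∸ k + (s + k)
    ≡⟨ cong (λ n → length X ∸ k + (s + n)) (sym (length-tabulate (λ i → i))) ⟩
  length X ∸ k + (s + length (allFin k))
    ≡⟨ cong (length X ∸ k +_) (sym (sum-map-suc (λ i → length (Q i)) (allFin k))) ⟩
  length X ∸ k + Σ[ k ] (λ i → suc (length (Q i)))  ∎
  where
  open ≡-Reasoning
  s : ℕ
  s = Σ[ k ] (λ i → length (Q i))

adj⇒∈ˡ : ∀ {G} → Simple G → ∀ {x y} → adj G x y ≡ true → x ∈ V G
adj⇒∈ˡ sG {x} {y} = inV sG x y

adj⇒∈ʳ : ∀ {G} → Simple G → ∀ {x y} → adj G x y ≡ true → y ∈ V G
adj⇒∈ʳ sG {x} {y} xy = inV sG y x (trans (Simple.sym sG y x) xy)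

module Union (G : Graph) (k : ℕ) (H : Fin k → Graph) where

  ∈-union⁺ˡ : ∀ {v} → v ∈ V G → v ∈ V (union G k H)
  ∈-union⁺ˡ = ∈-++⁺ˡ

  ∈-union⁺ʳ : ∀ i {v} → v ∈ V (H i) → v ∈ V (union G k H)
  ∈-union⁺ʳ i v∈Hi = ∈-++⁺ʳ (V G) (∈-concatMap⁺ (λ j → V (H j)) (lose (∈-allFin i) v∈Hi))

  ∈-union⁻ : ∀ {v} → v ∈ V (union G k H) → v ∈ V G ⊎ ∃[ i ] v ∈ V (H i)
  ∈-union⁻ v∈ with ∈-++⁻ (V G) v∈
  ... | inj₁ v∈G = inj₁ v∈G
  ... | inj₂ v∈Hs = inj₂ (satisfied (∈-concatMap⁻ (λ j → V (H j)) {xs = allFin k} v∈Hs))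

  adj-union⁺ˡ : ∀ {x y} → adj G x y ≡ true → adj (union G k H) x y ≡ true
  adj-union⁺ˡ xy = to T-≡ (from T-∨ (inj₁ (from T-≡ xy)))

  adj-union⁺ʳ : ∀ i {x y} → adj (H i) x y ≡ true → adj (union G k H) x y ≡ true
  adj-union⁺ʳ i {x} {y} xy =
    to T-≡ (from T-∨ (inj₂ (any⁺ (λ j → adj (H j) x y) (lose (∈-allFin i) (from T-≡ xy)))))

  adj-union⁻ : ∀ {x y} → adj (union G k H) x y ≡ true →
    adj G x y ≡ true ⊎ ∃[ i ] adj (H i) x y ≡ true
  adj-union⁻ {x} {y} xy with to T-∨ (from T-≡ xy)
  ... | inj₁ xy∈G = inj₁ (to T-≡ xy∈G)
  ... | inj₂ xy∈Hs =
    let i , xy∈Hi = satisfied (any⁻ (λ j → adj (H j) x y) (allFin k) xy∈Hs) in inj₂ (i , to T-≡ xy∈Hi)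

or-map-false : ∀ {A : Set} {f : A → Bool} → (∀ x → f x ≡ false) → ∀ xs → or (map f xs) ≡ false
or-map-false _ [] = refl
or-map-false {f = f} f≡false (x ∷ xs) rewrite f≡false x = or-map-false f≡false xs

Simple-union : ∀ {G k H} → Simple G → (∀ i → Simple (H i)) → Simple (union G k H)
Simple-union {G} {k} {H} sG sH = record
  { sym    = λ x y → cong₂ _∨_ (Simple.sym sG x y)
                        (cong or (map-cong (λ i → Simple.sym (sH i) x y) (allFin k)))
  ; irrefl = λ x → cong₂ _∨_ (irrefl sG x) (or-map-false (λ i → irrefl (sH i) x) (allFin k))
  ; inV    = λ x y xy → endpoint (adj-union⁻ xy)
  }
  where
  open Union G k H
  endpoint : ∀ {x y} → adj G x y ≡ true ⊎ ∃[ i ] adj (H i) x y ≡ true → x ∈ V (union G k H)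
  endpoint (inj₁ xy) = ∈-union⁺ˡ (adj⇒∈ˡ sG xy)
  endpoint (inj₂ (i , xy)) = ∈-union⁺ʳ i (adj⇒∈ˡ (sH i) xy)

-- Chrono without the final covering condition, recording the resulting blue set T instead.
data Run (G : Graph) : List ℕ → List (ℕ × ℕ) → List ℕ → Set where
  stop : ∀ {S} → Run G S [] S
  go   : ∀ {S a w L T} → ValidForce G S a w → Run G (w ∷ S) L T → Run G S ((a , w) ∷ L) T

Chrono⇒Run : ∀ {G S L} → Chrono G S L → ∃[ T ] (Run G S L T × V G ⊆ T)
Chrono⇒Run (done covered) = _ , stop , covered
Chrono⇒Run (force vf chrono) = let T , run , covered = Chrono⇒Run chrono in T , go vf run , covered

Run⇒Chrono : ∀ {G S L T} → Run G S L T → V G ⊆ T → Chrono G S L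
Run⇒Chrono stop covered = done covered
Run⇒Chrono (go vf run) covered = force vf (Run⇒Chrono run covered)

Run-⊆ : ∀ {G S L T} → Run G S L T → S ⊆ T
Run-⊆ stop v v∈S = v∈S
Run-⊆ (go _ run) v v∈S = Run-⊆ run v (there v∈S)

Run-++ : ∀ {G S L T M U} → Run G S L T → Run G T M U → Run G S (L ++ M) U
Run-++ stop run′ = run′
Run-++ (go vf run) run′ = go vf (Run-++ run run′)

Run-force : ∀ {G S L T a w} → Run G S L T → (a , w) ∈ L → w ∈ V G × adj G a w ≡ true × w ∉ S
Run-force (go (_ , w∈G , w∉S , aw , _) _) (here refl) = w∈G , aw , w∉S
Run-force (go _ run) (there aw∈L) =
  let w∈G , aw , w∉ = Run-force run aw∈L in w∈G , aw , (λ w∈S → w∉ (there w∈S))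

forcer-forces-once : ∀ {G S L T a w w′} → ValidForce G S a w → Run G (w ∷ S) L T →
  (a , w′) ∈ L → w′ ≡ w
forcer-forces-once (_ , _ , _ , _ , neighbours) run aw′∈L with Run-force run aw′∈L
... | w′∈G , aw′ , w′∉ with neighbours _ w′∈G aw′
...   | inj₁ w′∈S = ⊥-elim (w′∉ (there w′∈S))
...   | inj₂ w′≡w = w′≡w

Run-functional : ∀ {G S L T a w w′} → Run G S L T → (a , w) ∈ L → (a , w′) ∈ L → w ≡ w′
Run-functional (go _ _) (here refl) (here refl) = refl
Run-functional (go vf run) (here refl) (there aw′∈L) = sym (forcer-forces-once vf run aw′∈L)
Run-functional (go vf run) (there aw∈L) (here refl) = forcer-forces-once vf run aw∈L
Run-functional (go _ run) (there aw∈L) (there aw′∈L) = Run-functional run aw∈L aw′∈L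

ChainTo-inert : ∀ {L a t} → ChainTo L a t → ∀ w → (t , w) ∉ L
ChainTo-inert (end inert) = inert
ChainTo-inert (next _ chain) = ChainTo-inert chain

ChainTo-functional : ∀ {L} → (∀ {a w w′} → (a , w) ∈ L → (a , w′) ∈ L → w ≡ w′) →
  ∀ {a t t′} → ChainTo L a t → ChainTo L a t′ → t ≡ t′
ChainTo-functional _ (end _) (end _) = refl
ChainTo-functional _ (end inert) (next aw∈L _) = ⊥-elim (inert _ aw∈L)
ChainTo-functional _ (next aw∈L _) (end inert) = ⊥-elim (inert _ aw∈L)
ChainTo-functional functional (next aw∈L chain) (next aw′∈L chain′) with functional aw∈L aw′∈L
... | refl = ChainTo-functional functional chain chain′

-- Distinct terminals have distinct initial vertices, all lying in X.
terminals≤ : ∀ {G X L T k} {u : Fin k → ℕ} → Run G X L T → Injective _≡_ _≡_ u →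
  (∀ i → IsTerminal X L (u i)) → k ≤ length X
terminals≤ {X = X} {k = k} {u} run u-injective terminal =
  subst (_≤ length X) length-initials (Unique-⊆⇒length≤ initials-unique initials⊆X)
  where
  initial : Fin k → ℕ
  initial i = proj₁ (terminal i)
  initial-injective : Injective _≡_ _≡_ initial
  initial-injective {i} {j} eq with terminal i | terminal j
  ... | _ , _ , chain | _ , _ , chain′ rewrite eq =
    u-injective (ChainTo-functional (Run-functional run) chain chain′)
  initials-unique : Unique (map initial (allFin k))
  initials-unique = Unique.map⁺ initial-injective (Unique.allFin⁺ k)
  initials⊆X : map initial (allFin k) ⊆ X
  initials⊆X v v∈ with ∈-map⁻ initial v∈
  ... | i , _ , refl = proj₁ (proj₂ (terminal i))
  length-initials : length (map initial (allFin k)) ≡ k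
  length-initials = trans (length-map initial (allFin k)) (length-tabulate (λ i → i))

Transferable : Graph → Graph → List (ℕ × ℕ) → List ℕ → Set
Transferable G K L S = ∀ {a w} → (a , w) ∈ L → w ∈ V K → w ∉ S →
  adj K a w ≡ true × (∀ x → adj K a x ≡ true → adj G a x ≡ true ⊎ x ∈ S)

Transferable-∷ : ∀ {G K a w L S} → Transferable G K ((a , w) ∷ L) S → Transferable G K L (w ∷ S)
Transferable-∷ transferable bx∈L x∈K x∉wS with transferable (there bx∈L) x∈K (λ x∈S → x∉wS (there x∈S))
... | bx , neighbours = bx , λ y by → map₂ there (neighbours y by)

_⊆[_]_ : List ℕ → Graph → List ℕ → Set
S ⊆[ K ] S′ = ∀ v → v ∈ V K → v ∈ S → v ∈ S′

∷-⊆[] : ∀ {w S K S′} → (w ∈ V K → w ∈ S′) → S ⊆[ K ] S′ → (w ∷ S) ⊆[ K ] S′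
∷-⊆[] w∈S′ _ _ w∈K (here refl) = w∈S′ w∈K
∷-⊆[] _ S⊆S′ v v∈K (there v∈S) = S⊆S′ v v∈K v∈S

∷-mono-⊆[] : ∀ {w S K S′} → S ⊆[ K ] S′ → (w ∷ S) ⊆[ K ] (w ∷ S′)
∷-mono-⊆[] _ _ _ (here refl) = here refl
∷-mono-⊆[] S⊆S′ v v∈K (there v∈S) = there (S⊆S′ v v∈K v∈S)

-- Replaying the forces of L in K, skipping those whose target is already blue or lies outside K.
transfer : ∀ {G K S L T S′} → Simple G → Simple K → Run G S L T → Transferable G K L S′ →
  S ⊆[ K ] S′ → ∃₂ λ M T′ → Run K S′ M T′ × T ⊆[ K ] T′
transfer _ _ stop _ S⊆S′ = _ , _ , stop , S⊆S′
transfer {G} {K} {S′ = S′} sG sK (go {a = a} {w = w} (a∈S , _ , _ , _ , neighbours) run)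
  transferable S⊆S′ with w ∈? S′ | w ∈? V K
... | yes w∈S′ | _ =
  transfer sG sK run (λ bx∈L → transferable (there bx∈L)) (∷-⊆[] {K = K} (λ _ → w∈S′) S⊆S′)
... | no _ | no w∉K =
  transfer sG sK run (λ bx∈L → transferable (there bx∈L)) (∷-⊆[] {K = K} (λ w∈K → ⊥-elim (w∉K w∈K)) S⊆S′)
... | no w∉S′ | yes w∈K with transferable (here refl) w∈K w∉S′
...   | aw∈K , K-neighbours =
  let M , T′ , run′ , T⊆T′ =
        transfer sG sK run (Transferable-∷ {G} {K} {a} transferable) (∷-mono-⊆[] {K = K} S⊆S′)
  in (a , w) ∷ M , T′ , go valid run′ , T⊆T′
  where
  neighbour : ∀ x → x ∈ V K → adj K a x ≡ true → x ∈ S′ ⊎ x ≡ w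
  neighbour x x∈K ax with K-neighbours x ax
  ... | inj₂ x∈S′ = inj₁ x∈S′
  ... | inj₁ ax∈G with neighbours x (adj⇒∈ʳ sG ax∈G) ax∈G
  ...   | inj₁ x∈S = inj₁ (S⊆S′ x x∈K x∈S)
  ...   | inj₂ x≡w = inj₂ x≡w
  valid : ValidForce K S′ a w
  valid = S⊆S′ a (adj⇒∈ˡ sK aw∈K) a∈S , w∈K , w∉S′ , aw∈K , neighbour

module Attached (G : Graph) (sG : Simple G) (k : ℕ) (u : Fin k → ℕ) (H : Fin k → Graph)
  (sH : ∀ i → Simple (H i))
  (disjoint : ∀ i j → i ≢ j → ∀ v → v ∈ V (H i) → v ∈ V (H j) → ⊥)
  (attached : ∀ i → u i ∈ V (H i) × u i ∈ V G × (∀ v → v ∈ V (H i) → v ∈ V G → v ≡ u i)) where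

  open Union G k H

  G′ : Graph
  G′ = union G k H

  sG′ : Simple G′
  sG′ = Simple-union sG sH

  component-unique : ∀ {i j v} → v ∈ V (H i) → v ∈ V (H j) → i ≡ j
  component-unique {i} {j} {v} v∈Hi v∈Hj with i ≟ᶠ j
  ... | yes i≡j = i≡j
  ... | no i≢j = ⊥-elim (disjoint i j i≢j v v∈Hi v∈Hj)

  shared⇒attachment : ∀ i {v} → v ∈ V (H i) → v ∈ V G → v ≡ u i
  shared⇒attachment i = proj₂ (proj₂ (attached i)) _

  -- The only way into H i from outside is through u i.
  restrict-Transferable : ∀ i {S L T S′} → Run G′ S L T → Transferable G′ (H i) L (u i ∷ S′)
  restrict-Transferable i run {a} {w} aw∈L w∈Hi w∉ with adj-union⁻ (proj₁ (proj₂ (Run-force run aw∈L)))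
  ... | inj₁ aw∈G = ⊥-elim (w∉ (here (shared⇒attachment i w∈Hi (adj⇒∈ʳ sG aw∈G))))
  ... | inj₂ (j , aw∈Hj) with component-unique (adj⇒∈ʳ (sH j) aw∈Hj) w∈Hi
  ...   | refl = aw∈Hj , λ x ax → inj₁ (adj-union⁺ʳ i ax)

  -- A forcing vertex of G with a neighbour in some H i is u i, which does not force.
  lift-G-Transferable : ∀ {S L T S′} → Run G S L T → (∀ i w → (u i , w) ∉ L) → Transferable G G′ L S′
  lift-G-Transferable {S′ = S′} run inert {a} {w} aw∈L _ _ = adj-union⁺ˡ aw , neighbour
    where
    aw : adj G a w ≡ true
    aw = proj₁ (proj₂ (Run-force run aw∈L))
    neighbour : ∀ x → adj G′ a x ≡ true → adj G a x ≡ true ⊎ x ∈ S′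
    neighbour x ax with adj-union⁻ ax
    ... | inj₁ ax∈G = inj₁ ax∈G
    ... | inj₂ (i , ax∈Hi) with shared⇒attachment i (adj⇒∈ˡ (sH i) ax∈Hi) (adj⇒∈ˡ sG aw)
    ...   | refl = ⊥-elim (inert i w aw∈L)

  lift-H-Transferable : ∀ i {S L T S′} → Run (H i) S L T → V G ⊆ S′ → Transferable (H i) G′ L S′
  lift-H-Transferable i {S′ = S′} run VG⊆S′ {a} {w} aw∈L _ _ = adj-union⁺ʳ i aw , neighbour
    where
    aw : adj (H i) a w ≡ true
    aw = proj₁ (proj₂ (Run-force run aw∈L))
    neighbour : ∀ x → adj G′ a x ≡ true → adj (H i) a x ≡ true ⊎ x ∈ S′
    neighbour x ax with adj-union⁻ ax
    ... | inj₁ ax∈G = inj₂ (VG⊆S′ x (adj⇒∈ʳ sG ax∈G))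
    ... | inj₂ (j , ax∈Hj) with component-unique (adj⇒∈ˡ (sH j) ax∈Hj) (adj⇒∈ˡ (sH i) aw)
    ...   | refl = inj₁ ax∈Hj

  Inner : Fin k → ℕ → Set
  Inner i v = v ∈ V (H i) × v ≢ u i

  Inner? : ∀ i v → Dec (Inner i v)
  Inner? i v = v ∈? V (H i) ×-dec ¬? (v ≟ u i)

  inner : Fin k → List ℕ → List ℕ
  inner i = filter (Inner? i)

  ∈-inner⁺ : ∀ i {v S} → v ∈ S → Inner i v → v ∈ inner i S
  ∈-inner⁺ i = ∈-filter⁺ (Inner? i)

  ∈-inner⁻ : ∀ i {v} S → v ∈ inner i S → v ∈ S × Inner i v
  ∈-inner⁻ i S = ∈-filter⁻ (Inner? i) {xs = S}

  Unique-inner : ∀ i {S} → Unique S → Unique (inner i S)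
  Unique-inner i = Unique.filter⁺ (Inner? i)

  ∈-attach-inner : ∀ i {v S} → v ∈ S → v ∈ V (H i) → v ∈ u i ∷ inner i S
  ∈-attach-inner i {v} v∈S v∈Hi with v ≟ u i
  ... | yes refl = here refl
  ... | no v≢ui = there (∈-inner⁺ i v∈S (v∈Hi , v≢ui))

  Unique-attach-inner : ∀ i {S} → Unique S → Unique (u i ∷ inner i S)
  Unique-attach-inner i {S} S! =
    All.tabulate (λ v∈ ui≡v → proj₂ (proj₂ (∈-inner⁻ i S v∈)) (sym ui≡v)) ∷ Unique-inner i S!

  length-attach-inner : ∀ i {S} → VSet (H i) S → u i ∈ S → length S ≡ suc (length (inner i S))
  length-attach-inner i {S} (S! , S⊆Hi) ui∈S = ≤-antisym
    (Unique-⊆⇒length≤ S! (λ v v∈S → ∈-attach-inner i v∈S (S⊆Hi v v∈S)))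
    (Unique-⊆⇒length≤ (Unique-attach-inner i S!) attach-inner⊆S)
    where
    attach-inner⊆S : (u i ∷ inner i S) ⊆ S
    attach-inner⊆S _ (here refl) = ui∈S
    attach-inner⊆S v (there v∈) = proj₁ (∈-inner⁻ i S v∈)

  extend : List ℕ → (Fin k → List ℕ) → List ℕ
  extend X S = X ++ concatMap (λ i → inner i (S i)) (allFin k)

  ∈-inners⁻ : ∀ (S : Fin k → List ℕ) {v} → v ∈ concatMap (λ i → inner i (S i)) (allFin k) →
    ∃[ i ] (v ∈ S i × Inner i v)
  ∈-inners⁻ S v∈ with satisfied (∈-concatMap⁻ (λ i → inner i (S i)) {xs = allFin k} v∈)
  ... | i , v∈i = i , ∈-inner⁻ i (S i) v∈i

  Unique-extend : ∀ {X S} → VSet G X → (∀ i → Unique (S i)) → Unique (extend X S)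
  Unique-extend {X} {S} (X! , X⊆G) S! =
    Unique.++⁺ X! (Unique-concatMap⁺ (Unique.allFin⁺ k) (λ i → Unique-inner i (S! i)) same-component)
      λ (v∈X , v∈inners) → not-in-G v∈X (∈-inners⁻ S v∈inners)
    where
    same-component : ∀ {i j v} → v ∈ inner i (S i) → v ∈ inner j (S j) → i ≡ j
    same-component {i} {j} v∈i v∈j =
      component-unique (proj₁ (proj₂ (∈-inner⁻ i (S i) v∈i))) (proj₁ (proj₂ (∈-inner⁻ j (S j) v∈j)))
    not-in-G : ∀ {v} → v ∈ X → ∃[ i ] (v ∈ S i × Inner i v) → ⊥
    not-in-G {v} v∈X (i , _ , v∈Hi , v≢ui) = v≢ui (shared⇒attachment i v∈Hi (X⊆G v v∈X))

  inner⊆extend : ∀ {X} S i {v} → v ∈ inner i (S i) → v ∈ extend X S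
  inner⊆extend {X} S i v∈ = ∈-++⁺ʳ X (∈-concatMap⁺ (λ j → inner j (S j)) (lose (∈-allFin i) v∈))

  restriction : ∀ {B} → ZeroForcingSet G′ B → ∀ i → ZeroForcingSet (H i) (u i ∷ inner i B)
  restriction {B} ((B! , _) , _ , chrono) i with Chrono⇒Run chrono
  ... | _ , run , G′⊆T with transfer sG′ (sH i) run (restrict-Transferable i run)
                              (λ v v∈Hi v∈B → ∈-attach-inner i v∈B v∈Hi)
  ...   | M , _ , run′ , T⊆T′ = (Unique-attach-inner i B! , attach-inner⊆Hi) , M ,
            Run⇒Chrono run′ (λ v v∈Hi → T⊆T′ v v∈Hi (G′⊆T v (∈-union⁺ʳ i v∈Hi)))
    where
    attach-inner⊆Hi : ∀ v → v ∈ u i ∷ inner i B → v ∈ V (H i)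
    attach-inner⊆Hi _ (here refl) = proj₁ (attached i)
    attach-inner⊆Hi v (there v∈) = proj₁ (proj₂ (∈-inner⁻ i B v∈))

  Z-lower : ∀ {X z} → VSet G X → k ≤ length X → (∀ i → IsZ (H i) (u i ∷ []) (z i)) →
    ∀ B → ZeroForcingSet G′ B → X ⊆ B → (length X ∸ k) + Σ[ k ] z ≤ length B
  Z-lower {X} {z} X-set k≤X isZ B zfs@((B! , _) , _) X⊆B = begin
    length X ∸ k + Σ[ k ] z
      ≤⟨ +-monoʳ-≤ (length X ∸ k) (sum-map-mono z≤ (allFin k)) ⟩
    length X ∸ k + Σ[ k ] (λ i → suc (length (inner i B)))
      ≡⟨ sym (length-++-concatMap X k (λ i → inner i B) k≤X) ⟩
    length (extend X (λ _ → B))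
      ≤⟨ Unique-⊆⇒length≤ (Unique-extend X-set (λ _ → B!)) extend⊆B ⟩
    length B  ∎
    where
    open ≤-Reasoning
    z≤ : ∀ i → z i ≤ suc (length (inner i B))
    z≤ i = proj₂ (isZ i) _ (restriction zfs i) λ { _ (here refl) → here refl }
    extend⊆B : extend X (λ _ → B) ⊆ B
    extend⊆B v v∈ with ∈-++⁻ X v∈
    ... | inj₁ v∈X = X⊆B v v∈X
    ... | inj₂ v∈inners = proj₁ (proj₂ (∈-inners⁻ (λ _ → B) v∈inners))

  colour-G : ∀ {X L T} (B : Fin k → List ℕ) → Run G X L T → V G ⊆ T → (∀ i w → (u i , w) ∉ L) →
    (∀ i → B i ⊆ (u i ∷ inner i (B i))) →
    ∃₂ λ M T′ → Run G′ (extend X B) M T′ × V G ⊆ T′ × (∀ i → B i ⊆ T′)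
  colour-G {X} B run VG⊆T inert B⊆attach-inner
    with transfer sG sG′ run (lift-G-Transferable run inert) (λ v _ v∈X → ∈-++⁺ˡ v∈X)
  ... | M , T′ , run′ , T⊆T′ = M , T′ , run′ , VG⊆T′ , B⊆T′
    where
    VG⊆T′ : V G ⊆ T′
    VG⊆T′ v v∈G = T⊆T′ v (∈-union⁺ˡ v∈G) (VG⊆T v v∈G)
    B⊆T′ : ∀ i → B i ⊆ T′
    B⊆T′ i v v∈Bi with B⊆attach-inner i v v∈Bi
    ... | here refl = VG⊆T′ v (proj₁ (proj₂ (attached i)))
    ... | there v∈ = Run-⊆ run′ v (inner⊆extend B i v∈)

  colour-components : (B : Fin k → List ℕ) → (∀ i → ∃[ L ] Chrono (H i) (B i) L) →
    ∀ (I : List (Fin k)) {S} → V G ⊆ S → (∀ i → B i ⊆ S) →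
    ∃₂ λ M T → Run G′ S M T × S ⊆ T × (∀ i → i ∈ I → V (H i) ⊆ T)
  colour-components B chrono [] _ _ = [] , _ , stop , (λ _ v∈S → v∈S) , λ _ ()
  colour-components B chrono (i ∷ I) {S} VG⊆S B⊆S with Chrono⇒Run (proj₂ (chrono i))
  ... | _ , run , Hi⊆Ti with transfer (sH i) sG′ run (lift-H-Transferable i run VG⊆S) (λ v _ → B⊆S i v)
  ...   | M , T , run′ , Ti⊆T with colour-components B chrono I (λ v v∈G → Run-⊆ run′ v (VG⊆S v v∈G))
                                     (λ j v v∈Bj → Run-⊆ run′ v (B⊆S j v v∈Bj))
  ...     | M′ , U , run″ , T⊆U , I⊆U =
    M ++ M′ , U , Run-++ run′ run″ , (λ v v∈S → T⊆U v (Run-⊆ run′ v v∈S)) , covered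
    where
    covered : ∀ j → j ∈ i ∷ I → V (H j) ⊆ U
    covered _ (here refl) v v∈Hi = T⊆U v (Ti⊆T v (∈-union⁺ʳ i v∈Hi) (Hi⊆Ti v v∈Hi))
    covered j (there j∈I) = I⊆U j j∈I

  extend-ZeroForcingSet : ∀ {X L T} (B : Fin k → List ℕ) → VSet G X → Run G X L T → V G ⊆ T →
    (∀ i w → (u i , w) ∉ L) → (∀ i → ZeroForcingSet (H i) (B i)) → ZeroForcingSet G′ (extend X B)
  extend-ZeroForcingSet {X} B X-set@(_ , X⊆G) run VG⊆T inert B-zfs
    with colour-G B run VG⊆T inert (λ i v v∈Bi → ∈-attach-inner i v∈Bi (proj₂ (proj₁ (B-zfs i)) v v∈Bi))
  ... | M₁ , T₁ , run₁ , VG⊆T₁ , B⊆T₁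
    with colour-components B (λ i → proj₂ (B-zfs i)) (allFin k) VG⊆T₁ B⊆T₁
  ... | M₂ , U , run₂ , T₁⊆U , H⊆U =
    (Unique-extend X-set (λ i → proj₁ (proj₁ (B-zfs i))) , extend⊆G′) ,
    M₁ ++ M₂ , Run⇒Chrono (Run-++ run₁ run₂) covered
    where
    extend⊆G′ : ∀ v → v ∈ extend X B → v ∈ V G′
    extend⊆G′ v v∈ with ∈-++⁻ X v∈
    ... | inj₁ v∈X = ∈-union⁺ˡ (X⊆G v v∈X)
    ... | inj₂ v∈inners with ∈-inners⁻ B v∈inners
    ...   | i , _ , v∈Hi , _ = ∈-union⁺ʳ i v∈Hi
    covered : V G′ ⊆ U
    covered v v∈G′ with ∈-union⁻ v∈G′
    ... | inj₁ v∈G = T₁⊆U v (VG⊆T₁ v v∈G)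
    ... | inj₂ (i , v∈Hi) = H⊆U i (∈-allFin i) v v∈Hi

  length-extend : ∀ X (B : Fin k → List ℕ) → k ≤ length X → (∀ i → VSet (H i) (B i)) →
    (∀ i → u i ∈ B i) → length (extend X B) ≡ (length X ∸ k) + Σ[ k ] (λ i → length (B i))
  length-extend X B k≤X B-set ui∈B = trans (length-++-concatMap X k (λ i → inner i (B i)) k≤X)
    (cong (λ n → length X ∸ k + sum n)
      (map-cong (λ i → sym (length-attach-inner i (B-set i) (ui∈B i))) (allFin k)))

  Z-upper : ∀ {X L T z} → VSet G X → Run G X L T → V G ⊆ T → (∀ i w → (u i , w) ∉ L) →
    k ≤ length X → (∀ i → IsZ (H i) (u i ∷ []) (z i)) →
    ∃[ B ] (ZeroForcingSet G′ B × X ⊆ B × length B ≡ (length X ∸ k) + Σ[ k ] z)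
  Z-upper {X} {z = z} X-set run VG⊆T inert k≤X isZ =
    extend X B , extend-ZeroForcingSet B X-set run VG⊆T inert B-zfs , (λ _ → ∈-++⁺ˡ) , length≡
    where
    B : Fin k → List ℕ
    B i = proj₁ (proj₁ (isZ i))
    B-zfs : ∀ i → ZeroForcingSet (H i) (B i)
    B-zfs i = proj₁ (proj₂ (proj₁ (isZ i)))
    ui∈B : ∀ i → u i ∈ B i
    ui∈B i = proj₁ (proj₂ (proj₂ (proj₁ (isZ i)))) (u i) (here refl)
    length-B≡z : ∀ i → length (B i) ≡ z i
    length-B≡z i = proj₂ (proj₂ (proj₂ (proj₁ (isZ i))))
    length≡ : length (extend X B) ≡ (length X ∸ k) + Σ[ k ] z
    length≡ = trans (length-extend X B k≤X (λ i → proj₁ (B-zfs i)) ui∈B)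
      (cong (λ ns → length X ∸ k + sum ns) (map-cong length-B≡z (allFin k)))

proposition4p7 : (G : Graph) → Simple G → (X : List ℕ) → MinZeroForcingSet G X →
    (k : ℕ) (u : Fin k → ℕ) → Injective _≡_ _≡_ u →
    (∃[ L ] (ChronList G X L × (∀ i → IsTerminal X L (u i)))) →
    (H : Fin k → Graph) → (∀ i → Simple (H i)) → (∀ i → Connected (H i)) →
    (∀ i j → i ≢ j → ∀ v → v ∈ V (H i) → v ∈ V (H j) → ⊥) →
    (∀ i → u i ∈ V (H i) × u i ∈ V G × (∀ v → v ∈ V (H i) → v ∈ V G → v ≡ u i)) →
    (z : Fin k → ℕ) → (∀ i → IsZ (H i) (u i ∷ []) (z i)) →
    IsZ (union G k H) X ((length X ∸ k) + Σ[ k ] z)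
proposition4p7 G sG X ((X-set , _) , _) k u u-injective (L , chrono , terminal)
  H sH _ disjoint attached z isZ
  with Chrono⇒Run chrono
... | _ , run , VG⊆T = Z-upper X-set run VG⊆T inert k≤X isZ , Z-lower X-set k≤X isZ
  where
  open Attached G sG k u H sH disjoint attached
  inert : ∀ i w → (u i , w) ∉ L
  inert i = ChainTo-inert (proj₂ (proj₂ (terminal i)))
  k≤X : k ≤ length X
  k≤X = terminals≤ run u-injective terminal
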